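{- Let $G$ be a connected simple undirected graph with edge lengths $\ell\colon E(G)\to\mathbb{R}_{>0}$, and let $\varphi,\psi\colon\mathbb{R}\to\mathbb{R}$ be non-decreasing functions. If $C\subseteq E(G)$ is a $\varphi$-contraction for $G$ and $C'$ is a $\psi$-contraction for the contracted graph $G/C$, then $C\cup C'$ is a $(\psi\circ\varphi)$-contraction for $G$, where $(\psi\circ\varphi)(x)=\psi(\varphi(x))$. The same holds with "weak $\varphi$-contraction", "weak $\psi$-contraction" and "weak $(\psi\circ\varphi)$-contraction" in place of the respective non-weak notions.
   Context: For $C\subseteq E$, $G/C$ is the simple graph obtained from $G$ by contracting the edges of $C$, deleting loops and keeping among parallel edges only one of minimum length; equivalently for distances, $\ell_C$ is the length function equal to $0$ on $C$ and to $\ell$ on $E\setminus C$, and $\mathrm{dist}_{\ell}(u,v)$ denotes shortest-path distance with respect to $\ell$. A tolerance function is a non-decreasing $\varphi\colon\mathbb{R}\to\mathbb{R}$. A set $C\subseteq E$ is a $\varphi$-contraction if $\mathrm{dist}_{\ell_C}(u,v)\ge\varphi(\mathrm{dist}_\ell(u,v))$ for all vertices $u,v$. It is a weak $\varphi$-contraction if for all $u,v$ either $\mathrm{dist}_{\ell_C}(u,v)=0$ or $\mathrm{dist}_{\ell_C}(u,v)\ge\varphi(\mathrm{dist}_\ell(u,v))$, and the graph $(V,C)$ is disconnected. Edges of $C'$ in $G/C$ are identified with the corresponding edges of $G$. -}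

module Defs where

open import Level using (0ℓ)
open import Data.Nat using (ℕ)
open import Data.Fin using (Fin; _≟_)
open import Data.Fin.Properties using (any?)
open import Data.Bool using (Bool; true; false; if_then_else_; _∨_)
open import Data.Bool.Properties renaming (_≟_ to _≟ᵇ_)
open import Data.Product using (Σ; ∃; _×_; _,_)
open import Data.Sum using (_⊎_)
open import Relation.Nullary using (¬_)
open import Relation.Nullary.Decidable using (⌊_⌋; _×-dec_)
open import Relation.Binary.PropositionalEquality using (_≡_; _≢_)
open import Relation.Binary.Structures using (IsTotalOrder)
open import Function.Definitions using (Injective)

-- Domain of lengths.  ℝ is not available in agda-stdlib, so lengths
-- and tolerance functions take values in an arbitrary totally ordered
-- commutative monoid (ℝ with 0, +, ≤, < is an instance).

record LengthDomain : Set₁ where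
  infixl 6 _+_
  infix 4 _≤_ _<_
  field
    Carrier      : Set
    0#           : Carrier
    _+_          : Carrier → Carrier → Carrier
    _≤_          : Carrier → Carrier → Set
    _<_          : Carrier → Carrier → Set
    isTotalOrder : IsTotalOrder _≡_ _≤_
    +-assoc      : ∀ x y z → (x + y) + z ≡ x + (y + z)
    +-comm       : ∀ x y → x + y ≡ y + x
    +-identityˡ  : ∀ x → 0# + x ≡ x
    +-mono-≤     : ∀ {x y u v} → x ≤ y → u ≤ v → x + u ≤ y + v
    <⇔≤∧≢        : ∀ {x y} → (x < y → (x ≤ y × x ≢ y)) × ((x ≤ y × x ≢ y) → x < y)

record Graph : Set where
  field
    n    : ℕ
    m    : ℕ
    src  : Fin m → Fin n
    tgt  : Fin m → Fin n

Joins : (G : Graph) → Fin (Graph.m G) → Fin (Graph.n G) → Fin (Graph.n G) → Set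
Joins G e u w = (Graph.src G e ≡ u × Graph.tgt G e ≡ w) ⊎ (Graph.src G e ≡ w × Graph.tgt G e ≡ u)

Simple : Graph → Set
Simple G = (∀ e → Graph.src G e ≢ Graph.tgt G e)
         × (∀ e f → Joins G f (Graph.src G e) (Graph.tgt G e) → e ≡ f)

EdgeSet : Graph → Set
EdgeSet G = Fin (Graph.m G) → Bool

data Walk (G : Graph) : Fin (Graph.n G) → Fin (Graph.n G) → Set where
  []   : ∀ {u} → Walk G u u
  step : ∀ {u w v} (e : Fin (Graph.m G)) → Joins G e u w → Walk G w v → Walk G u v

data InSet (G : Graph) (C : EdgeSet G) : ∀ {u v} → Walk G u v → Set where
  []   : ∀ {u} → InSet G C ([] {u = u})
  step : ∀ {u w v} {e} {j : Joins G e u w} {p : Walk G w v} →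
         C e ≡ true → InSet G C p → InSet G C (step e j p)

Connected : Graph → Set
Connected G = ∀ u v → Walk G u v

SubDisconnected : (G : Graph) → EdgeSet G → Set
SubDisconnected G C = Σ (Fin (Graph.n G)) λ u → Σ (Fin (Graph.n G)) λ v →
  ¬ (Σ (Walk G u v) λ p → InSet G C p)

module _ (D : LengthDomain) where
  open LengthDomain D

  Lengths : Graph → Set
  Lengths G = Fin (Graph.m G) → Carrier

  PositiveLengths : (G : Graph) → Lengths G → Set
  PositiveLengths G ℓ = ∀ e → 0# < ℓ e

  contractLen : (G : Graph) → Lengths G → EdgeSet G → Lengths G
  contractLen G ℓ C e = if C e then 0# else ℓ e

  walkLen : (G : Graph) → Lengths G → ∀ {u v} → Walk G u v → Carrier
  walkLen G ℓ []           = 0#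
  walkLen G ℓ (step e _ p) = ℓ e + walkLen G ℓ p

  IsDist : (G : Graph) → Lengths G → Fin (Graph.n G) → Fin (Graph.n G) → Carrier → Set
  IsDist G ℓ u v d = Σ (Walk G u v) (λ p → walkLen G ℓ p ≡ d)
                   × (∀ (p : Walk G u v) → d ≤ walkLen G ℓ p)

  NonDecreasing : (Carrier → Carrier) → Set
  NonDecreasing φ = ∀ {x y} → x ≤ y → φ x ≤ φ y

  IsContraction : (G : Graph) → Lengths G → (Carrier → Carrier) → EdgeSet G → Set
  IsContraction G ℓ φ C = ∀ u v d dC → IsDist G ℓ u v d →
    IsDist G (contractLen G ℓ C) u v dC → φ d ≤ dC

  IsWeakContraction : (G : Graph) → Lengths G → (Carrier → Carrier) → EdgeSet G → Set
  IsWeakContraction G ℓ φ C =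
    (∀ u v d dC → IsDist G ℓ u v d →
       IsDist G (contractLen G ℓ C) u v dC → (dC ≡ 0# ⊎ φ d ≤ dC))
    × SubDisconnected G C

  -- (H, ℓH) is the contracted graph G/C: π maps vertices of G onto vertices
  -- of H, identifying exactly the vertices joined by C-paths; ι identifies
  -- each edge of H with an edge of G (of the same length) whose endpoints
  -- are mapped to its endpoints; every edge of G not becoming a loop has a
  -- parallel representative in H of no greater length (only a shortest
  -- among parallel edges is kept); H is simple.
  record IsQuotient (G : Graph) (ℓ : Lengths G) (C : EdgeSet G)
                    (H : Graph) (ℓH : Lengths H)
                    (π : Fin (Graph.n G) → Fin (Graph.n H))
                    (ι : Fin (Graph.m H) → Fin (Graph.m G)) : Set where
    field
      π-surj     : ∀ x → Σ (Fin (Graph.n G)) λ u → π u ≡ x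
      π-glue     : ∀ u v → (π u ≡ π v → Σ (Walk G u v) λ p → InSet G C p)
                         × (Σ (Walk G u v) (λ p → InSet G C p) → π u ≡ π v)
      ι-inj      : Injective _≡_ _≡_ ι
      ι-ends     : ∀ e' → Joins H e' (π (Graph.src G (ι e'))) (π (Graph.tgt G (ι e')))
      ι-len      : ∀ e' → ℓH e' ≡ ℓ (ι e')
      ι-notC     : ∀ e' → C (ι e') ≡ false
      kept-min   : ∀ e → π (Graph.src G e) ≢ π (Graph.tgt G e) →
                   Σ (Fin (Graph.m H)) λ e' →
                     Joins H e' (π (Graph.src G e)) (π (Graph.tgt G e)) × ℓH e' ≤ ℓ e
      H-simple   : Simple H

  -- C ∪ C', where the edges of C' ⊆ E(G/C) are identified with edges of G via ι
  unionVia : (G H : Graph) → (Fin (Graph.m H) → Fin (Graph.m G)) →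
             EdgeSet G → EdgeSet H → EdgeSet G
  unionVia G H ι C C' e =
    C e ∨ ⌊ any? (λ e' → (ι e' ≟ e) ×-dec (C' e' ≟ᵇ true)) ⌋

  _∘φ_ : (Carrier → Carrier) → (Carrier → Carrier) → (Carrier → Carrier)
  (ψ ∘φ φ) x = ψ (φ x)

module Submission where

-- Fix u, v and write U = C ∪ ι(C'), d = dist_ℓ(u,v), dC = dist_{ℓ_C}(u,v),
-- dH = dist_{ℓH}(πu,πv), dH' = dist_{ℓH_C'}(πu,πv) and dU = dist_{ℓ_U}(u,v).
-- Walks move between G and its quotient H = G/C without getting longer: a walk
-- of H lifts to G by gluing its steps with C-walks (of length 0 once C is
-- contracted), and a walk of G projects to H by dropping collapsed edges and
-- replacing every other edge by its shortest kept representative.  Hence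
-- dC ≤ dH and dH' ≤ dU, and with φ d ≤ dC, ψ dH ≤ dH' and ψ non-decreasing,
-- ψ (φ d) ≤ dU.  In the weak case dU ≤ dC and dU ≤ dH' settle the vanishing
-- alternatives, and a pair disconnected by C' in H pulls back to a pair
-- disconnected by U in G.  Only the distance from u to v is given, so the
-- intermediate distances are produced by showing that shortest walks exist:
-- every walk shortens to a path, paths have fewer steps than there are
-- vertices, and the walks of boundedly many steps can be listed.

open import Defs
open import Data.Nat as ℕ using (ℕ; zero; suc)
open import Data.Nat.Properties as ℕ using ()
open import Data.Fin using (Fin; _≟_)
open import Data.Fin.Properties using (injective⇒≤)
open import Data.Bool using (true; false)
open import Data.Product using (Σ; _×_; _,_; proj₁; proj₂)
open import Data.Sum using (_⊎_; inj₁; inj₂)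
open import Data.Empty using (⊥-elim)
open import Data.List using (List; []; _∷_; _++_; concatMap; map; allFin)
open import Data.List.Relation.Unary.Any as Any using (Any; here)
open import Data.List.Relation.Unary.Any.Properties using (++⁺ˡ; ++⁺ʳ; concatMap⁺; map⁺)
open import Data.List.Membership.Propositional.Properties using (∈-allFin)
open import Data.Vec using (Vec; []; _∷_)
open import Data.Vec.Relation.Unary.All using (All; []; _∷_)
open import Data.Vec.Relation.Unary.Unique.Propositional using (Unique)
open import Data.Vec.Relation.Unary.Unique.Propositional.Properties using (lookup-injective)
open import Relation.Nullary using (¬_; Dec; yes; no)
open import Relation.Nullary.Decidable using (_×-dec_; _⊎-dec_; toWitness; fromWitness)
open import Data.Bool.Properties using (T-≡; T-∨)
open import Function using (_∘_; Equivalence)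
open Equivalence using (to; from)
import Data.Sum as Sum
open import Relation.Binary.Bundles using (TotalOrder)
open import Relation.Binary.Structures using (IsTotalOrder)
open import Relation.Binary.PropositionalEquality
  using (_≡_; _≢_; refl; sym; trans; cong; cong₂; subst; module ≡-Reasoning)

module LengthOrder (D : LengthDomain) where
  open LengthDomain D public
  open IsTotalOrder isTotalOrder public using ()
    renaming (refl to ≤-refl; trans to ≤-trans; reflexive to ≤-reflexive; antisym to ≤-antisym)

  totalOrder : TotalOrder _ _ _
  totalOrder = record { isTotalOrder = isTotalOrder }

  +-identityʳ : ∀ x → x + 0# ≡ x
  +-identityʳ x = trans (+-comm x 0#) (+-identityˡ x)

  <⇒≤ : ∀ {x y} → x < y → x ≤ y
  <⇒≤ x<y = proj₁ (proj₁ <⇔≤∧≢ x<y)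

  <⇒≢ : ∀ {x y} → x < y → x ≢ y
  <⇒≢ x<y = proj₂ (proj₁ <⇔≤∧≢ x<y)

  x≤y+x : ∀ {x y} → 0# ≤ y → x ≤ y + x
  x≤y+x {x} {y} 0≤y = subst (_≤ y + x) (+-identityˡ x) (+-mono-≤ 0≤y ≤-refl)

  x≤x+y : ∀ {x y} → 0# ≤ y → x ≤ x + y
  x≤x+y {x} {y} 0≤y = subst (_≤ x + y) (+-identityʳ x) (+-mono-≤ ≤-refl 0≤y)

  0≤x+y : ∀ {x y} → 0# ≤ x → 0# ≤ y → 0# ≤ x + y
  0≤x+y {x} {y} 0≤x 0≤y = subst (_≤ x + y) (+-identityˡ 0#) (+-mono-≤ 0≤x 0≤y)

  module _ {φ ψ : Carrier → Carrier} (ψ-mono : ∀ {x y} → x ≤ y → ψ x ≤ ψ y) where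

    composed-bound : ∀ {d dC dH dH' dU} →
      φ d ≤ dC → dC ≤ dH → ψ dH ≤ dH' → dH' ≤ dU → ψ (φ d) ≤ dU
    composed-bound φd≤dC dC≤dH ψdH≤dH' dH'≤dU =
      ≤-trans (ψ-mono (≤-trans φd≤dC dC≤dH)) (≤-trans ψdH≤dH' dH'≤dU)

    -- weak version: a vanishing dC or dH' forces dU = 0, since 0 ≤ dU ≤ dC, dH'
    composed-bound-weak : ∀ {d dC dH dH' dU} → 0# ≤ dU → dU ≤ dC → dU ≤ dH' →
      dC ≤ dH → dH' ≤ dU → (dC ≡ 0# ⊎ φ d ≤ dC) → (dH' ≡ 0# ⊎ ψ dH ≤ dH') →
      dU ≡ 0# ⊎ ψ (φ d) ≤ dU
    composed-bound-weak 0≤dU dU≤dC _ _ _ (inj₁ dC≡0) _ =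
      inj₁ (≤-antisym (≤-trans dU≤dC (≤-reflexive dC≡0)) 0≤dU)
    composed-bound-weak 0≤dU _ dU≤dH' _ _ (inj₂ _) (inj₁ dH'≡0) =
      inj₁ (≤-antisym (≤-trans dU≤dH' (≤-reflexive dH'≡0)) 0≤dU)
    composed-bound-weak _ _ _ dC≤dH dH'≤dU (inj₂ φd≤dC) (inj₂ ψdH≤dH') =
      inj₂ (composed-bound φd≤dC dC≤dH ψdH≤dH' dH'≤dU)

module Walks (D : LengthDomain) (K : Graph) where
  open LengthOrder D
  import Data.List.Extrema totalOrder as Extrema
  open import Data.Vec.Membership.DecPropositional (_≟_ {Graph.n K}) using (_∈_; _∈?_)
  open import Data.Vec.Relation.Unary.Any using (here; there)
  open import Data.Vec.Relation.Unary.AllPairs using ([]; _∷_)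

  V : Set
  V = Fin (Graph.n K)

  E : Set
  E = Fin (Graph.m K)

  len : Lengths D K → ∀ {u v} → Walk K u v → Carrier
  len = walkLen D K

  infixr 5 _++ʷ_
  _++ʷ_ : ∀ {u w v} → Walk K u w → Walk K w v → Walk K u v
  []           ++ʷ q = q
  step e j p   ++ʷ q = step e j (p ++ʷ q)

  len-++ : ∀ λ' {u w v} (p : Walk K u w) (q : Walk K w v) → len λ' (p ++ʷ q) ≡ len λ' p + len λ' q
  len-++ λ' []           q = sym (+-identityˡ _)
  len-++ λ' (step e j p) q = trans (cong (λ' e +_) (len-++ λ' p q)) (sym (+-assoc _ _ _))

  castˡ : ∀ {a b c} → a ≡ b → Walk K b c → Walk K a c
  castˡ refl q = q

  len-castˡ : ∀ λ' {a b c} (eq : a ≡ b) (q : Walk K b c) → len λ' (castˡ eq q) ≡ len λ' q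
  len-castˡ λ' refl q = refl

  swap : ∀ {e a b} → Joins K e a b → Joins K e b a
  swap (inj₁ ends) = inj₂ ends
  swap (inj₂ ends) = inj₁ ends

  joins-parallel : ∀ {e f x w} → Joins K e x w → Joins K f x w →
                   Joins K f (Graph.src K e) (Graph.tgt K e)
  joins-parallel (inj₁ (refl , refl)) jf = jf
  joins-parallel (inj₂ (refl , refl)) jf = swap jf

  joins? : ∀ e u w → Dec (Joins K e u w)
  joins? e u w = ((Graph.src K e ≟ u) ×-dec (Graph.tgt K e ≟ w))
           ⊎-dec ((Graph.src K e ≟ w) ×-dec (Graph.tgt K e ≟ u))

  joins-ends : ∀ {e x w a b} → Joins K e x w → Joins K e a b →
               (a ≡ x × b ≡ w) ⊎ (b ≡ x × a ≡ w)
  joins-ends (inj₁ (refl , refl)) (inj₁ (refl , refl)) = inj₁ (refl , refl)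
  joins-ends (inj₁ (refl , refl)) (inj₂ (refl , refl)) = inj₂ (refl , refl)
  joins-ends (inj₂ (refl , refl)) (inj₁ (refl , refl)) = inj₂ (refl , refl)
  joins-ends (inj₂ (refl , refl)) (inj₂ (refl , refl)) = inj₁ (refl , refl)

  _⊆_ : EdgeSet K → EdgeSet K → Set
  X ⊆ Y = ∀ e → X e ≡ true → Y e ≡ true

  InSet-mono : ∀ {X Y} → X ⊆ Y →
               ∀ {u v} {p : Walk K u v} → InSet K X p → InSet K Y p
  InSet-mono X⊆Y []               = []
  InSet-mono X⊆Y (step {e = e} x r) = step (X⊆Y e x) (InSet-mono X⊆Y r)

  NonNegative : Lengths D K → Set
  NonNegative λ' = ∀ e → 0# ≤ λ' e

  len-nonneg : ∀ {λ'} → NonNegative λ' → ∀ {u v} (p : Walk K u v) → 0# ≤ len λ' p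
  len-nonneg nn []           = ≤-refl
  len-nonneg nn (step e j p) = 0≤x+y (nn e) (len-nonneg nn p)

  contract-nonneg : ∀ {λ'} → NonNegative λ' → ∀ X → NonNegative (contractLen D K λ' X)
  contract-nonneg nn X e with X e
  ... | true  = ≤-refl
  ... | false = nn e

  contract-≤ : ∀ {λ'} → NonNegative λ' → ∀ X e → contractLen D K λ' X e ≤ λ' e
  contract-≤ nn X e with X e
  ... | true  = nn e
  ... | false = ≤-refl

  contract-antitone : ∀ {λ'} → NonNegative λ' → ∀ {X Y} → X ⊆ Y →
                      ∀ {u v} (p : Walk K u v) → len (contractLen D K λ' Y) p ≤ len (contractLen D K λ' X) p
  contract-antitone nn X⊆Y []           = ≤-refl
  contract-antitone {λ'} nn {X} {Y} X⊆Y (step e j p) = +-mono-≤ edge (contract-antitone nn X⊆Y p)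
    where
    edge : contractLen D K λ' Y e ≤ contractLen D K λ' X e
    edge with X e in Xe
    ... | true rewrite X⊆Y e Xe = ≤-refl
    ... | false = contract-≤ nn Y e

  InSet⇒len≡0 : ∀ λ' X {u v} {p : Walk K u v} → InSet K X p → len (contractLen D K λ' X) p ≡ 0#
  InSet⇒len≡0 λ' X []                 = refl
  InSet⇒len≡0 λ' X (step {e = e} x r) rewrite x | InSet⇒len≡0 λ' X r = +-identityˡ 0#

  len≤0⇒InSet : ∀ {λ'} → (∀ e → 0# < λ' e) → ∀ X {u v} (p : Walk K u v) →
                len (contractLen D K λ' X) p ≤ 0# → InSet K X p
  len≤0⇒InSet pos X []           _ = []
  len≤0⇒InSet pos X (step e j p) h with X e in x
  ... | true  = step x (len≤0⇒InSet pos X p (subst (_≤ 0#) (+-identityˡ _) h))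
  ... | false = ⊥-elim (<⇒≢ (pos e) (≤-antisym (<⇒≤ (pos e)) (≤-trans (x≤x+y rest≥0) h)))
    where
    rest≥0 : 0# ≤ len (contractLen D K _ X) p
    rest≥0 = len-nonneg (contract-nonneg (λ e → <⇒≤ (pos e)) X) p

  dist-nonneg : ∀ {λ'} → NonNegative λ' → ∀ {u v d} → IsDist D K λ' u v d → 0# ≤ d
  dist-nonneg nn ((p , len-p) , _) = subst (0# ≤_) len-p (len-nonneg nn p)

  steps : ∀ {u v} → Walk K u v → ℕ
  steps []           = 0
  steps (step _ _ p) = suc (steps p)

  vertices : ∀ {u v} (p : Walk K u v) → Vec V (suc (steps p))
  vertices {u} []           = u ∷ []
  vertices {u} (step e j p) = u ∷ vertices p

  IsPath : ∀ {u v} → Walk K u v → Set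
  IsPath p = Unique (vertices p)

  -- pigeonhole: a path has fewer steps than there are vertices
  path-steps : ∀ {u v} {p : Walk K u v} → IsPath p → suc (steps p) ℕ.≤ Graph.n K
  path-steps {p = p} uniq = injective⇒≤ (λ {i} {j} → lookup-injective uniq i j)

  ∉⇒All≢ : ∀ {u k} {xs : Vec V k} → ¬ (u ∈ xs) → All (u ≢_) xs
  ∉⇒All≢ {xs = []}     u∉ = []
  ∉⇒All≢ {xs = x ∷ xs} u∉ = (λ u≡x → u∉ (here u≡x)) ∷ ∉⇒All≢ (λ m → u∉ (there m))

  stay : ∀ u v → List (Walk K u v)
  stay u v with u ≟ v
  ... | yes refl = [] ∷ []
  ... | no  _    = []

  stay-complete : ∀ λ' {u} → Any (λ r → len λ' r ≤ len λ' ([] {u = u})) (stay u u)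
  stay-complete λ' {u} with u ≟ u
  ... | yes refl = here ≤-refl
  ... | no  u≢u  = ⊥-elim (u≢u refl)

  walksUpTo : ℕ → ∀ u v → List (Walk K u v)
  walksAlong : ℕ → ∀ u v → E → List (Walk K u v)
  walksVia   : ℕ → E → ∀ u w v → List (Walk K u v)
  walksUpTo zero    u v = stay u v
  walksUpTo (suc k) u v = stay u v ++ concatMap (walksAlong k u v) (allFin _)
  walksAlong k u v e = concatMap (λ w → walksVia k e u w v) (allFin _)
  walksVia k e u w v with joins? e u w
  ... | yes j = map (step e j) (walksUpTo k w v)
  ... | no  _ = []

  walksUpTo-complete : ∀ λ' k {u v} (p : Walk K u v) → steps p ℕ.≤ k →
                       Any (λ r → len λ' r ≤ len λ' p) (walksUpTo k u v)
  walksUpTo-complete λ' zero    []           _           = stay-complete λ'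
  walksUpTo-complete λ' (suc k) []           _           = ++⁺ˡ (stay-complete λ')
  walksUpTo-complete λ' (suc k) {u} {v} (step {w = w} e j p) (ℕ.s≤s p≤k) =
    ++⁺ʳ (stay u v) (concatMap⁺ (walksAlong k u v) (Any.map (λ { refl →
      concatMap⁺ (λ w → walksVia k e u w v) (Any.map (λ { refl → via-complete }) (∈-allFin w)) })
      (∈-allFin e)))
    where
    via-complete : Any (λ r → len λ' r ≤ len λ' (step e j p)) (walksVia k e u w v)
    via-complete with joins? e u w
    ... | yes _  = map⁺ (Any.map (+-mono-≤ ≤-refl) (walksUpTo-complete λ' k p p≤k))
    ... | no ¬j = ⊥-elim (¬j j)

  module _ {λ' : Lengths D K} (nn : NonNegative λ') where

    suffixFrom : ∀ {u w v} (q : Walk K w v) → u ∈ vertices q → IsPath q →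
                 Σ (Walk K u v) λ r → IsPath r × len λ' r ≤ len λ' q
    suffixFrom []           (here refl) uniq       = [] , uniq , ≤-refl
    suffixFrom (step e j q) (here refl) uniq       = step e j q , uniq , ≤-refl
    suffixFrom (step e j q) (there m)   (_ ∷ uniq) =
      let r , r-path , r≤q = suffixFrom q m uniq in r , r-path , ≤-trans r≤q (x≤y+x (nn e))

    shortcut : ∀ {u v} (p : Walk K u v) → Σ (Walk K u v) λ r → IsPath r × len λ' r ≤ len λ' p
    shortcut []                 = [] , ([] ∷ []) , ≤-refl
    shortcut {u} (step e j p) with shortcut p
    ... | q , q-path , q≤p with u ∈? vertices q
    ...   | yes u∈q = let r , r-path , r≤q = suffixFrom q u∈q q-path
                      in r , r-path , ≤-trans r≤q (≤-trans q≤p (x≤y+x (nn e)))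
    ...   | no  u∉q = step e j q , (∉⇒All≢ u∉q ∷ q-path) , +-mono-≤ ≤-refl q≤p

    -- a shortest walk exists between any two vertices joined by some walk:
    -- the shortest of the (finitely many) walks with fewer steps than vertices
    shortest-exists : ∀ {u v} → Walk K u v → Σ Carrier (IsDist D K λ' u v)
    shortest-exists {u} {v} p₀ = len λ' best , (best , refl) , best≤
      where
      candidates : List (Walk K u v)
      candidates = walksUpTo (Graph.n K) u v
      best : Walk K u v
      best = Extrema.argmin (len λ') p₀ candidates
      best≤ : ∀ p → len λ' best ≤ len λ' p
      best≤ p =
        let r , r-path , r≤p = shortcut p
            r-listed = walksUpTo-complete λ' _ r (ℕ.<⇒≤ (path-steps r-path))
        in Extrema.f[argmin]≤v⁺ p₀ candidates (inj₂ (Any.map (λ r′≤r → ≤-trans r′≤r r≤p) r-listed))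

module _ (D : LengthDomain) where
  open LengthOrder D

  dist-≤-by-transfer : ∀ {K₁ K₂ λ₁ λ₂ a b x y d₁ d₂} →
    IsDist D K₁ λ₁ a b d₁ → IsDist D K₂ λ₂ x y d₂ →
    (∀ (q : Walk K₂ x y) → Σ (Walk K₁ a b) λ r → walkLen D K₁ λ₁ r ≤ walkLen D K₂ λ₂ q) →
    d₁ ≤ d₂
  dist-≤-by-transfer (_ , shortest₁) ((q , len-q) , _) transfer =
    let r , r≤q = transfer q in ≤-trans (shortest₁ r) (≤-trans r≤q (≤-reflexive len-q))

module Quotient (D : LengthDomain) {G : Graph} {ℓ : Lengths D G} (pos : PositiveLengths D G ℓ)
                {C : EdgeSet G} {H : Graph} {ℓH : Lengths D H}
                {π : Fin (Graph.n G) → Fin (Graph.n H)} {ι : Fin (Graph.m H) → Fin (Graph.m G)}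
                (Q : IsQuotient D G ℓ C H ℓH π ι) where
  open LengthOrder D
  open IsQuotient Q
  module WG = Walks D G
  module WH = Walks D H
  open WG using (_++ʷ_; _⊆_)

  src tgt : Fin (Graph.m G) → Fin (Graph.n G)
  src = Graph.src G
  tgt = Graph.tgt G

  ℓ⟨_⟩ : EdgeSet G → Lengths D G
  ℓ⟨ X ⟩ = contractLen D G ℓ X

  ℓH⟨_⟩ : EdgeSet H → Lengths D H
  ℓH⟨ X' ⟩ = contractLen D H ℓH X'

  ℓ-nonneg : WG.NonNegative ℓ
  ℓ-nonneg e = <⇒≤ (pos e)

  ℓH-pos : ∀ e' → 0# < ℓH e'
  ℓH-pos e' = subst (0# <_) (sym (ι-len e')) (pos (ι e'))

  ℓH-nonneg : WH.NonNegative ℓH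
  ℓH-nonneg e' = <⇒≤ (ℓH-pos e')

  C-collapsed : ∀ e → C e ≡ true → π (src e) ≡ π (tgt e)
  C-collapsed e Ce = proj₂ (π-glue _ _) (step e (inj₁ (refl , refl)) [] , step Ce [])

  glue : ∀ {X} → C ⊆ X → ∀ u v → π u ≡ π v → Σ (Walk G u v) λ c → WG.len ℓ⟨ X ⟩ c ≡ 0#
  glue {X} C⊆X u v πu≡πv =
    let c , c-in-C = proj₁ (π-glue u v) πu≡πv
    in c , WG.InSet⇒len≡0 ℓ X (WG.InSet-mono C⊆X c-in-C)

  module _ (X : EdgeSet G) (X' : EdgeSet H) (C⊆X : C ⊆ X)
           (X'⊆X : ∀ e' → X' e' ≡ true → X (ι e') ≡ true) where

    lift-edge-≤ : ∀ e' → ℓ⟨ X ⟩ (ι e') ≤ ℓH⟨ X' ⟩ e'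
    lift-edge-≤ e' with X' e' in X'e'
    ... | true rewrite X'⊆X e' X'e' = ≤-refl
    ... | false = subst (ℓ⟨ X ⟩ (ι e') ≤_) (sym (ι-len e')) (WG.contract-≤ ℓ-nonneg X (ι e'))

    lift-along : ∀ {e' u a b} → Joins G (ι e') a b → π u ≡ π a →
                 Σ (Walk G u b) λ r → WG.len ℓ⟨ X ⟩ r ≤ ℓH⟨ X' ⟩ e'
    lift-along {e'} {u} {a} j πu≡πa = c ++ʷ step (ι e') j [] , ≤-trans (≤-reflexive cost) (lift-edge-≤ e')
      where
      open ≡-Reasoning
      c = proj₁ (glue C⊆X u a πu≡πa)
      cost : WG.len ℓ⟨ X ⟩ (c ++ʷ step (ι e') j []) ≡ ℓ⟨ X ⟩ (ι e')
      cost = begin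
        WG.len ℓ⟨ X ⟩ (c ++ʷ step (ι e') j [])    ≡⟨ WG.len-++ ℓ⟨ X ⟩ c _ ⟩
        WG.len ℓ⟨ X ⟩ c + (ℓ⟨ X ⟩ (ι e') + 0#)      ≡⟨ cong₂ _+_ (proj₂ (glue C⊆X u a πu≡πa)) (+-identityʳ _) ⟩
        0# + ℓ⟨ X ⟩ (ι e')                          ≡⟨ +-identityˡ _ ⟩
        ℓ⟨ X ⟩ (ι e')                               ∎

    lift-step : ∀ {e' x w u} → Joins H e' x w → π u ≡ x →
                Σ (Fin (Graph.n G)) λ u₂ → π u₂ ≡ w × Σ (Walk G u u₂) λ r → WG.len ℓ⟨ X ⟩ r ≤ ℓH⟨ X' ⟩ e'
    lift-step {e'} j πu≡x with WH.joins-ends j (ι-ends e')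
    ... | inj₁ (a≡x , b≡w) = _ , b≡w , lift-along (inj₁ (refl , refl)) (trans πu≡x (sym a≡x))
    ... | inj₂ (b≡x , a≡w) = _ , a≡w , lift-along (inj₂ (refl , refl)) (trans πu≡x (sym b≡x))

    lift : ∀ {x y} (q : Walk H x y) u v → π u ≡ x → π v ≡ y →
           Σ (Walk G u v) λ r → WG.len ℓ⟨ X ⟩ r ≤ WH.len ℓH⟨ X' ⟩ q
    lift [] u v πu≡x πv≡x =
      let c , len-c = glue C⊆X u v (trans πu≡x (sym πv≡x)) in c , ≤-reflexive len-c
    lift (step e' j q) u v πu≡x πv≡y with lift-step j πu≡x
    ... | u₂ , πu₂≡w , r , r≤e' with lift q u₂ v πu₂≡w πv≡y
    ...   | r′ , r′≤q = r ++ʷ r′ , ≤-trans (≤-reflexive (WG.len-++ ℓ⟨ X ⟩ r r′)) (+-mono-≤ r≤e' r′≤q)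

  Compatible : EdgeSet G → EdgeSet H → Set
  Compatible X X' = ∀ e → π (src e) ≢ π (tgt e) → X e ≡ true →
                    ∀ k → Joins H k (π (src e)) (π (tgt e)) → X' k ≡ true

  joins-π : ∀ {e u w k} → Joins G e u w → Joins H k (π (src e)) (π (tgt e)) → Joins H k (π u) (π w)
  joins-π (inj₁ (refl , refl)) jk = jk
  joins-π (inj₂ (refl , refl)) jk = WH.swap jk

  collapsed-π : ∀ {e u w} → Joins G e u w → π (src e) ≡ π (tgt e) → π u ≡ π w
  collapsed-π (inj₁ (refl , refl)) eq = eq
  collapsed-π (inj₂ (refl , refl)) eq = sym eq

  module _ {X : EdgeSet G} {X' : EdgeSet H} (compatible : Compatible X X') where

    project-edge-≤ : ∀ e (apart : π (src e) ≢ π (tgt e)) k → Joins H k (π (src e)) (π (tgt e)) →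
                     ℓH k ≤ ℓ e → ℓH⟨ X' ⟩ k ≤ ℓ⟨ X ⟩ e
    project-edge-≤ e apart k jk k≤e with X e in Xe
    ... | true rewrite compatible e apart Xe k jk = ≤-refl
    ... | false = ≤-trans (WH.contract-≤ ℓH-nonneg X' k) k≤e

    project : ∀ {u v} (p : Walk G u v) → Σ (Walk H (π u) (π v)) λ q → WH.len ℓH⟨ X' ⟩ q ≤ WG.len ℓ⟨ X ⟩ p
    project [] = [] , ≤-refl
    project (step e j p) with project p | π (src e) ≟ π (tgt e)
    ... | q , q≤p | yes together =
      WH.castˡ (collapsed-π j together) q ,
      ≤-trans (≤-reflexive (WH.len-castˡ ℓH⟨ X' ⟩ (collapsed-π j together) q))
              (≤-trans q≤p (x≤y+x (WG.contract-nonneg ℓ-nonneg X e)))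
    ... | q , q≤p | no apart =
      let k , jk , k≤e = kept-min e apart
      in step k (joins-π j jk) q , +-mono-≤ (project-edge-≤ e apart k jk k≤e) q≤p

  module Union (C' : EdgeSet H) where

    U : EdgeSet G
    U = unionVia D G H ι C C'

    InImage : Fin (Graph.m G) → Set
    InImage e = Σ (Fin (Graph.m H)) λ e' → ι e' ≡ e × C' e' ≡ true

    U-intro : ∀ {e} → C e ≡ true ⊎ InImage e → U e ≡ true
    U-intro = to T-≡ ∘ from T-∨ ∘ Sum.map (from T-≡) fromWitness

    U-elim : ∀ {e} → U e ≡ true → C e ≡ true ⊎ InImage e
    U-elim = Sum.map (to T-≡) toWitness ∘ to T-∨ ∘ from T-≡

    C⊆U : C ⊆ U
    C⊆U e Ce = U-intro (inj₁ Ce)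

    C'⊆U : ∀ e' → C' e' ≡ true → U (ι e') ≡ true
    C'⊆U e' C'e' = U-intro (inj₂ (e' , refl , C'e'))

    -- an edge of U surviving in H lies in ι(C'), and since H is simple its
    -- only representative is its C'-preimage
    U-compatible : Compatible U C'
    U-compatible e apart Ue k jk with U-elim Ue
    ... | inj₁ Ce                  = ⊥-elim (apart (C-collapsed e Ce))
    ... | inj₂ (e' , refl , C'e') =
      subst (λ f → C' f ≡ true) (proj₂ H-simple e' k (WH.joins-parallel (ι-ends e') jk)) C'e'

    ℓ⟨U⟩-nonneg : WG.NonNegative ℓ⟨ U ⟩
    ℓ⟨U⟩-nonneg = WG.contract-nonneg ℓ-nonneg U

    record Intermediate (u v : Fin (Graph.n G)) (dU : Carrier) : Set where
      field
        dC dH dH' : Carrier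
        dC-dist   : IsDist D G ℓ⟨ C ⟩ u v dC
        dH-dist   : IsDist D H ℓH (π u) (π v) dH
        dH'-dist  : IsDist D H ℓH⟨ C' ⟩ (π u) (π v) dH'
        dC≤dH     : dC ≤ dH
        dH'≤dU    : dH' ≤ dU
        dU≤dC     : dU ≤ dC
        dU≤dH'    : dU ≤ dH'
        0≤dU      : 0# ≤ dU

    intermediate : ∀ {u v dU} → Walk G u v → IsDist D G ℓ⟨ U ⟩ u v dU → Intermediate u v dU
    intermediate {u} {v} p dU-dist = record
      { dC-dist  = proj₂ dC-exists
      ; dH-dist  = proj₂ dH-exists
      ; dH'-dist = proj₂ dH'-exists
      ; dC≤dH    = dist-≤-by-transfer D (proj₂ dC-exists) (proj₂ dH-exists)
                     (λ q → lift C (λ _ → false) (λ _ Ce → Ce) (λ _ ()) q u v refl refl)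
      ; dH'≤dU   = dist-≤-by-transfer D (proj₂ dH'-exists) dU-dist (project U-compatible)
      ; dU≤dC    = dist-≤-by-transfer D dU-dist (proj₂ dC-exists)
                     (λ r → r , WG.contract-antitone ℓ-nonneg C⊆U r)
      ; dU≤dH'   = dist-≤-by-transfer D dU-dist (proj₂ dH'-exists)
                     (λ q → lift U C' C⊆U C'⊆U q u v refl refl)
      ; 0≤dU     = WG.dist-nonneg ℓ⟨U⟩-nonneg dU-dist
      }
      where
      q : Walk H (π u) (π v)
      q = proj₁ (project U-compatible p)
      dC-exists : Σ Carrier (IsDist D G ℓ⟨ C ⟩ u v)
      dC-exists = WG.shortest-exists (WG.contract-nonneg ℓ-nonneg C) p
      dH-exists : Σ Carrier (IsDist D H ℓH (π u) (π v))
      dH-exists = WH.shortest-exists ℓH-nonneg q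
      dH'-exists : Σ Carrier (IsDist D H ℓH⟨ C' ⟩ (π u) (π v))
      dH'-exists = WH.shortest-exists (WH.contract-nonneg ℓH-nonneg C') q

    -- a U-walk between preimages of x, y projects to a C'-walk from x to y
    U-disconnected : SubDisconnected H C' → SubDisconnected G U
    U-disconnected (x , y , no-C'-walk) with π-surj x | π-surj y
    ... | u , refl | v , refl = u , v , λ (p , p-in-U) → no-C'-walk (C'-walk p p-in-U)
      where
      C'-walk : (p : Walk G u v) → InSet G U p → Σ (Walk H (π u) (π v)) (InSet H C')
      C'-walk p p-in-U =
        let q , q≤p = project U-compatible p
        in q , WH.len≤0⇒InSet ℓH-pos C' q (≤-trans q≤p (≤-reflexive (WG.InSet⇒len≡0 ℓ U p-in-U)))

    -- C ∪ C' is a (ψ ∘ φ)-contraction; only ψ needs to be non-decreasing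
    composition : (φ ψ : Carrier → Carrier) → NonDecreasing D ψ →
      IsContraction D G ℓ φ C → IsContraction D H ℓH ψ C' → IsContraction D G ℓ (_∘φ_ D ψ φ) U
    composition φ ψ ψ-mono C-contr C'-contr u v d dU d-dist dU-dist =
      composed-bound {φ = φ} ψ-mono (C-contr u v d dC d-dist dC-dist) dC≤dH
                            (C'-contr (π u) (π v) dH dH' dH-dist dH'-dist) dH'≤dU
      where open Intermediate (intermediate (proj₁ (proj₁ d-dist)) dU-dist)

    weak-composition : (φ ψ : Carrier → Carrier) → NonDecreasing D ψ →
      IsWeakContraction D G ℓ φ C → IsWeakContraction D H ℓH ψ C' →
      IsWeakContraction D G ℓ (_∘φ_ D ψ φ) U
    weak-composition φ ψ ψ-mono (C-contr , _) (C'-contr , C'-disconnected) =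
      bound , U-disconnected C'-disconnected
      where
      bound : ∀ u v d dU → IsDist D G ℓ u v d → IsDist D G ℓ⟨ U ⟩ u v dU → dU ≡ 0# ⊎ ψ (φ d) ≤ dU
      bound u v d dU d-dist dU-dist =
        composed-bound-weak {φ = φ} ψ-mono 0≤dU dU≤dC dU≤dH' dC≤dH dH'≤dU
          (C-contr u v d dC d-dist dC-dist) (C'-contr (π u) (π v) dH dH' dH-dist dH'-dist)
        where open Intermediate (intermediate (proj₁ (proj₁ d-dist)) dU-dist)

theorem1 : (D : LengthDomain) →
    let open LengthDomain D in
    (G : Graph) → Simple G → Connected G →
    (ℓ : Lengths D G) → PositiveLengths D G ℓ →
    (φ ψ : Carrier → Carrier) → NonDecreasing D φ → NonDecreasing D ψ →
    (C : EdgeSet G) →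
    (H : Graph) (ℓH : Lengths D H) →
    (π : Fin (Graph.n G) → Fin (Graph.n H)) →
    (ι : Fin (Graph.m H) → Fin (Graph.m G)) →
    IsQuotient D G ℓ C H ℓH π ι →
    (C' : EdgeSet H) →
    (IsContraction D G ℓ φ C → IsContraction D H ℓH ψ C' →
       IsContraction D G ℓ (_∘φ_ D ψ φ) (unionVia D G H ι C C'))
    × (IsWeakContraction D G ℓ φ C → IsWeakContraction D H ℓH ψ C' →
       IsWeakContraction D G ℓ (_∘φ_ D ψ φ) (unionVia D G H ι C C'))
theorem1 D G _ _ ℓ pos φ ψ _ ψ-mono C H ℓH π ι Q C' =
  composition φ ψ ψ-mono , weak-composition φ ψ ψ-mono
  where open Quotient.Union D pos Q C'
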